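{- Let $A$ be an adinkraizable $(n,k)$-chromotopology. Then every labeled switching class of $A$ contains exactly $2^{2^{n-k}-1}$ odd dashings.
   Context: A chromotopology of dimension $n$ is a finite connected simple bipartite $n$-regular graph with edges colored by $[n]$, each vertex incident to exactly one edge of each color, such that for distinct colors $i,j$ the edges of colors $i,j$ form a disjoint union of $4$-cycles ($2$-colored $4$-cycles). Every chromotopology is isomorphic to a quotient $I^n_c/L$ (vertex set $\mathbf{Z}_2^n/L$, an edge of color $i$ joining $C$ and $C+e_i$) for a unique subspace $L\subseteq\mathbf{Z}_2^n$; it is an $(n,k)$-chromotopology if $\dim L=k$ (so it has $2^{n-k}$ vertices). An odd dashing is a map $d\colon E(A)\to\mathbf{Z}_2$ summing to $1$ over every $2$-colored $4$-cycle. $A$ is adinkraizable if it admits an odd dashing and a ranking (a function $h\colon V\to\mathbf{Z}$ with $|h(u)-h(w)|=1$ on every edge). The vertex switch at $v$ changes $d(e)$ to $d(e)+1$ for every edge $e$ incident to $v$ and leaves other edges unchanged; it maps odd dashings to odd dashings. The labeled switching classes are the orbits of the set of odd dashings under the group generated by all vertex switches. -}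

module Defs where

open import Data.Nat using (ℕ; zero; suc; _^_)
open import Data.Bool using (Bool; true; false; _xor_; if_then_else_)
open import Data.Fin using (Fin)
open import Data.Fin.Properties using (_≟_)
open import Data.Vec using (Vec; []; _∷_; lookup; foldr)
open import Data.List using (List; []; _∷_; _++_; map; filter; length)
open import Data.Integer using (ℤ; _-_; ∣_∣)
open import Data.Product using (Σ; _×_; _,_)
open import Relation.Nullary using (¬_; Dec; yes; no)
open import Relation.Unary using (Decidable)
open import Relation.Binary.PropositionalEquality using (_≡_; _≢_)
open import Data.Fin.Properties using (all?)
open import Data.Vec.Properties using (≡-dec)
open import Data.Bool.Properties using () renaming (_≟_ to _≟B_)

data Conn {n N : ℕ} (nbr : Fin n → Fin N → Fin N) : Fin N → Fin N → Set where
  here : ∀ {v} → Conn nbr v v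
  step : ∀ {v w} (i : Fin n) → Conn nbr (nbr i v) w → Conn nbr v w

-- Every vertex v has exactly one edge of each color i, joining v to nbr i v;
-- the edge of color i is {v , nbr i v} (so nbr i is a fixed-point-free involution).
record Chromotopology (n N : ℕ) : Set where
  field
    nbr        : Fin n → Fin N → Fin N
    involutive : ∀ i v → nbr i (nbr i v) ≡ v
    loopless   : ∀ i v → nbr i v ≢ v
    simple     : ∀ i j v → nbr i v ≡ nbr j v → i ≡ j
    bipartite  : Σ (Fin N → Bool) λ c → ∀ i v → c (nbr i v) ≢ c v
    connected  : ∀ v w → Conn nbr v w
    -- edges of colors i ≠ j form a disjoint union of 4-cycles:
    -- alternating i,j,i,j from any vertex returns to it after 4 steps
    squares    : ∀ i j v → i ≢ j → nbr j (nbr i (nbr j (nbr i v))) ≡ v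

open Chromotopology public

-- A dashing candidate: a Z₂-value (Bool, addition = xor) for each (color, vertex)
-- slot; it is a map on edges when it is symmetric along each edge.
Dashing : ℕ → ℕ → Set
Dashing n N = Vec (Vec Bool N) n

val : ∀ {n N} → Dashing n N → Fin n → Fin N → Bool
val d i v = lookup (lookup d i) v

IsEdgeMap : ∀ {n N} → Chromotopology n N → Dashing n N → Set
IsEdgeMap A d = ∀ i v → val d i v ≡ val d i (nbr A i v)

-- The 2-colored 4-cycle through v with colors i, j:
-- v -i- a -j- b -i- c -j- v, edges (i,v), (j,a), (i,b), (j,c).
OddDashing : ∀ {n N} → Chromotopology n N → Dashing n N → Set
OddDashing A d = IsEdgeMap A d ×
  (∀ i j v → i ≢ j →
    let a = nbr A i v
        b = nbr A j a
        c = nbr A i b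
    in (val d i v xor val d j a) xor (val d i b xor val d j c) ≡ true)

Ranking : ∀ {n N} → Chromotopology n N → (Fin N → ℤ) → Set
Ranking A h = ∀ i v → ∣ h v - h (nbr A i v) ∣ ≡ 1

Adinkraizable : ∀ {n N} → Chromotopology n N → Set
Adinkraizable {n} {N} A =
  Σ (Dashing n N) (OddDashing A) × Σ (Fin N → ℤ) (Ranking A)

isYes : {P : Set} → Dec P → Bool
isYes (yes _) = true
isYes (no _)  = false

switch : ∀ {n N} → Chromotopology n N → Fin N → Dashing n N → Dashing n N
switch {n} {N} A v d = Data.Vec.tabulate λ i → Data.Vec.tabulate λ w →
  val d i w xor (isYes (w ≟ v) Data.Bool.∨ isYes (nbr A i w ≟ v))

-- Reachability by finitely many vertex switches = orbit under the group
-- generated by vertex switches (each switch is an involution).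
data SameClass {n N} (A : Chromotopology n N) : Dashing n N → Dashing n N → Set where
  refl-cls : ∀ {d} → SameClass A d d
  step-cls : ∀ {d e} (v : Fin N) → SameClass A (switch A v d) e → SameClass A d e

-- The subspace L ⊆ Z₂ⁿ: vectors x whose color-translation fixes every vertex
-- (A ≅ I^n_c / L for exactly this L).
act : ∀ {n N} → Chromotopology n N → Vec Bool n → Fin N → Fin N
act {n} A x v =
  Data.List.foldr (λ i w → if lookup x i then nbr A i w else w) v (Data.List.allFin n)

InL : ∀ {n N} → Chromotopology n N → Vec Bool n → Set
InL A x = ∀ v → act A x v ≡ v

inL? : ∀ {n N} (A : Chromotopology n N) → Decidable (InL A)
inL? A x = all? λ v → act A x v ≟ v

allVecs : (n : ℕ) → List (Vec Bool n)
allVecs zero    = [] ∷ []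
allVecs (suc n) = map (false ∷_) (allVecs n) ++ map (true ∷_) (allVecs n)

-- A is an (n,k)-chromotopology: dim L = k, i.e. |L| = 2^k.
IsNK : ∀ {n N} → Chromotopology n N → ℕ → Set
IsNK {n} A k = length (filter (inL? A) (allVecs n)) ≡ 2 ^ k

-- Switching at a set S of vertices adds to a dashing the coboundary δS (the edge
-- uv gets S u + S v), and the switching class of d is exactly {d + δS}. A
-- coboundary sums to zero around every 2-colored square, so the whole class
-- consists of odd dashings; on a connected graph δS = δT iff S + T is constant,
-- so the class has 2^(|V| - 1) elements. Finally Z₂ⁿ acts on the vertices by
-- walking along the colors; the action is transitive and L is the stabiliser of
-- every vertex, so |V| · 2^k = 2^n.
module Submission where

open import Defs
open import Algebra.Bundles using (CommutativeRing)
open import Data.Bool using (Bool; true; false; T; _xor_; _∨_; if_then_else_)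
open import Data.Bool.Properties
  using (T?; xor-∧-commutativeRing; xor-comm; xor-assoc; xor-same; xor-identityʳ)
open import Data.Empty using (⊥-elim)
open import Data.Fin using (Fin; zero; suc)
open import Data.Fin.Properties using (_≟_; suc-injective)
open import Data.List using (List; []; _∷_; _++_; length; map; filter; filterᵇ; foldr; allFin)
open import Data.List.Properties using (map-cong; map-∘; map-++; length-++; length-map; filter-all)
open import Data.List.Membership.Propositional using (_∈_; _∉_)
open import Data.List.Membership.Propositional.Properties
  using (∈-allFin; ∈-map⁺; ∈-map⁻; ∈-++⁺ˡ; ∈-++⁺ʳ; ∈-filter⁺; ∈-filter⁻)
open import Data.List.Relation.Unary.All using ([]; universal)
import Data.List.Relation.Unary.All as All
open import Data.List.Relation.Unary.All.Properties using (All¬⇒¬Any)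
open import Data.List.Relation.Unary.AllPairs using ([]; _∷_)
open import Data.List.Relation.Unary.Any using (here; there)
open import Data.List.Relation.Unary.Unique.Propositional using (Unique)
open import Data.List.Relation.Unary.Unique.Propositional.Properties
  using (allFin⁺; map⁺; ++⁺; filter⁺)
open import Data.Nat using (ℕ; zero; suc; _+_; _*_; _^_; _∸_; _≤_; s≤s; z≤n)
open import Data.Nat.ListAction using (sum)
open import Data.Nat.ListAction.Properties using (sum-++)
open import Data.Nat.Properties
  using (+-0-commutativeMonoid; +-comm; +-identityʳ; *-identityˡ; *-cancelʳ-≡; ^-distribˡ-+-*;
         ^-monoʳ-<; m^n≢0; m^n>0; m∸n+n≡m; m≤m+n; ≤-trans; ≤-reflexive; ≮⇒≥; <⇒≱; <⇒≢)
open import Data.Product using (Σ; _×_; _,_; proj₂)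
open import Data.Unit using (tt)
open import Data.Vec using (Vec; []; _∷_; lookup; tabulate; zipWith; replicate)
open import Data.Vec.Properties
  using (lookup∘tabulate; tabulate∘lookup; tabulate-cong; lookup-zipWith; zipWith-comm; lookup-replicate)
open import Function using (_∘_; const)
open import Function.Bundles using (_⇔_; mk⇔)
open import Relation.Nullary using (¬_; Dec; yes; no)
open import Relation.Binary.PropositionalEquality
  using (_≡_; _≢_; refl; sym; trans; cong; cong₂; subst; module ≡-Reasoning)

open CommutativeRing xor-∧-commutativeRing using (+-commutativeSemigroup; +-group)
open import Algebra.Properties.CommutativeSemigroup +-commutativeSemigroup using (interchange)
open import Algebra.Properties.Group +-group using (∙-cancelˡ; x∙y⁻¹≈ε⇒x≈y; x≈y⇒x∙y⁻¹≈ε)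
open import Algebra.Properties.CommutativeMonoid.Sum +-0-commutativeMonoid
  using (sum-syntax; sum-cong-≗; ∑-distrib-+; sum-replicate-zero)

open ≡-Reasoning

xor-telescope : ∀ x y z → (x xor y) xor (y xor z) ≡ x xor z
xor-telescope x y z = begin
  (x xor y) xor (y xor z) ≡⟨ xor-assoc x y (y xor z) ⟩
  x xor (y xor (y xor z)) ≡⟨ cong (x xor_) (sym (xor-assoc y y z)) ⟩
  x xor ((y xor y) xor z) ≡⟨ cong (λ t → x xor (t xor z)) (xor-same y) ⟩
  x xor z                 ∎

xor-perturb : ∀ p q r o a b c e → (a xor b) xor (c xor e) ≡ false →
  ((p xor a) xor (q xor b)) xor ((r xor c) xor (o xor e)) ≡ (p xor q) xor (r xor o)
xor-perturb p q r o a b c e abce≡false = begin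
  ((p xor a) xor (q xor b)) xor ((r xor c) xor (o xor e))
    ≡⟨ cong₂ _xor_ (interchange p a q b) (interchange r c o e) ⟩
  ((p xor q) xor (a xor b)) xor ((r xor o) xor (c xor e))
    ≡⟨ interchange (p xor q) (a xor b) (r xor o) (c xor e) ⟩
  ((p xor q) xor (r xor o)) xor ((a xor b) xor (c xor e))
    ≡⟨ cong (((p xor q) xor (r xor o)) xor_) abce≡false ⟩
  ((p xor q) xor (r xor o)) xor false
    ≡⟨ xor-identityʳ _ ⟩
  (p xor q) xor (r xor o) ∎

xor≡false⇒≡ : ∀ x y → x xor y ≡ false → x ≡ y
xor≡false⇒≡ = x∙y⁻¹≈ε⇒x≈y

≡⇒xor≡false : ∀ {x y} → x ≡ y → x xor y ≡ false
≡⇒xor≡false = x≈y⇒x∙y⁻¹≈ε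

xor-cancelˡ : ∀ x y z → x xor y ≡ x xor z → y ≡ z
xor-cancelˡ = ∙-cancelˡ

lookup-ext : ∀ {A : Set} {m} {x y : Vec A m} → (∀ i → lookup x i ≡ lookup y i) → x ≡ y
lookup-ext {x = x} {y} p = trans (sym (tabulate∘lookup x)) (trans (tabulate-cong p) (tabulate∘lookup y))

dashing-ext : ∀ {n N} {d e : Dashing n N} → (∀ i v → val d i v ≡ val e i v) → d ≡ e
dashing-ext p = lookup-ext λ i → lookup-ext (p i)

val-tabulate : ∀ {n N} (f : Fin n → Fin N → Bool) i v → val (tabulate λ i → tabulate (f i)) i v ≡ f i v
val-tabulate f i v = trans (cong (λ r → lookup r v) (lookup∘tabulate _ i)) (lookup∘tabulate (f i) v)

χ : {P : Set} → Dec P → ℕ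
χ (yes _) = 1
χ (no _)  = 0

χ-iff : {P Q : Set} (p : Dec P) (q : Dec Q) → (P → Q) → (Q → P) → χ p ≡ χ q
χ-iff (yes _) (yes _) _ _ = refl
χ-iff (yes p) (no ¬q) f _ = ⊥-elim (¬q (f p))
χ-iff (no ¬p) (yes q) _ g = ⊥-elim (¬p (g q))
χ-iff (no _)  (no _)  _ _ = refl

∑-const : ∀ N c → ∑[ w < N ] c ≡ N * c
∑-const zero    c = refl
∑-const (suc N) c = cong (c +_) (∑-const N c)

∑-χ-≟ : ∀ {N} (a : Fin N) → ∑[ w < N ] χ (a ≟ w) ≡ 1
∑-χ-≟ {suc N} zero    = cong suc (sum-replicate-zero N)
∑-χ-≟ {suc N} (suc a) =
  trans (sum-cong-≗ λ w → χ-iff (suc a ≟ suc w) (a ≟ w) suc-injective (cong suc)) (∑-χ-≟ a)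

sum-map-∑-comm : ∀ {X : Set} {N} (g : X → Fin N → ℕ) xs →
  sum (map (λ x → ∑[ w < N ] g x w) xs) ≡ ∑[ w < N ] sum (map (λ x → g x w) xs)
sum-map-∑-comm {N = N} g [] = sym (sum-replicate-zero N)
sum-map-∑-comm g (x ∷ xs) =
  trans (cong (∑[ w < _ ] g x w +_) (sum-map-∑-comm g xs)) (sym (∑-distrib-+ (g x) _))

length-filter≡sum-χ : ∀ {X : Set} {P : X → Set} (P? : ∀ x → Dec (P x)) xs →
  length (filter P? xs) ≡ sum (map (χ ∘ P?) xs)
length-filter≡sum-χ P? []       = refl
length-filter≡sum-χ P? (x ∷ xs) with P? x
... | yes _ = cong suc (length-filter≡sum-χ P? xs)
... | no  _ = length-filter≡sum-χ P? xs

m*2^k≡2^n⇒m≡2^[n∸k] : ∀ m k n → m * 2 ^ k ≡ 2 ^ n → m ≡ 2 ^ (n ∸ k)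
m*2^k≡2^n⇒m≡2^[n∸k] zero    k n eq = ⊥-elim (<⇒≢ (m^n>0 2 n) eq)
m*2^k≡2^n⇒m≡2^[n∸k] (suc m) k n eq = *-cancelʳ-≡ (suc m) (2 ^ (n ∸ k)) (2 ^ k) {{m^n≢0 2 k}} (begin
  suc m * 2 ^ k     ≡⟨ eq ⟩
  2 ^ n             ≡⟨ cong (2 ^_) (m∸n+n≡m k≤n) ⟨
  2 ^ (n ∸ k + k)   ≡⟨ ^-distribˡ-+-* 2 (n ∸ k) k ⟩
  2 ^ (n ∸ k) * 2 ^ k ∎)
  where
  k≤n : k ≤ n
  k≤n = ≮⇒≥ λ n<k → <⇒≱ (^-monoʳ-< 2 (s≤s (s≤s z≤n)) n<k)
                        (≤-trans (m≤m+n (2 ^ k) (m * 2 ^ k)) (≤-reflexive eq))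

-- The cube Z₂ⁿ

_⊕_ : ∀ {n} → Vec Bool n → Vec Bool n → Vec Bool n
_⊕_ = zipWith _xor_

cubeSum : ∀ n → (Vec Bool n → ℕ) → ℕ
cubeSum n f = sum (map f (allVecs n))

cubeSum-suc : ∀ n (f : Vec Bool (suc n) → ℕ) →
  cubeSum (suc n) f ≡ cubeSum n (f ∘ (false ∷_)) + cubeSum n (f ∘ (true ∷_))
cubeSum-suc n f = begin
  sum (map f (map (false ∷_) xs ++ map (true ∷_) xs))
    ≡⟨ cong sum (map-++ f (map (false ∷_) xs) _) ⟩
  sum (map f (map (false ∷_) xs) ++ map f (map (true ∷_) xs))
    ≡⟨ sum-++ (map f (map (false ∷_) xs)) _ ⟩
  sum (map f (map (false ∷_) xs)) + sum (map f (map (true ∷_) xs))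
    ≡⟨ cong₂ (λ l r → sum l + sum r) (map-∘ xs) (map-∘ xs) ⟨
  cubeSum n (f ∘ (false ∷_)) + cubeSum n (f ∘ (true ∷_)) ∎
  where xs = allVecs n

cubeSum-one : ∀ n → cubeSum n (const 1) ≡ 2 ^ n
cubeSum-one zero    = refl
cubeSum-one (suc n) = trans (cubeSum-suc n (const 1))
  (cong₂ _+_ (cubeSum-one n) (trans (cubeSum-one n) (sym (+-identityʳ _))))

cubeSum-translate : ∀ n (c : Vec Bool n) (f : Vec Bool n → ℕ) → cubeSum n (λ x → f (x ⊕ c)) ≡ cubeSum n f
cubeSum-translate zero    []      f = refl
cubeSum-translate (suc n) (b ∷ c) f = begin
  cubeSum (suc n) (λ x → f (x ⊕ (b ∷ c)))
    ≡⟨ cubeSum-suc n _ ⟩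
  cubeSum n (λ x → f ((false xor b) ∷ (x ⊕ c))) + cubeSum n (λ x → f ((true xor b) ∷ (x ⊕ c)))
    ≡⟨ cong₂ _+_ (cubeSum-translate n c _) (cubeSum-translate n c _) ⟩
  cubeSum n (f ∘ ((false xor b) ∷_)) + cubeSum n (f ∘ ((true xor b) ∷_))
    ≡⟨ swap-halves b ⟩
  cubeSum n (f ∘ (false ∷_)) + cubeSum n (f ∘ (true ∷_))
    ≡⟨ cubeSum-suc n f ⟨
  cubeSum (suc n) f ∎
  where
  swap-halves : ∀ b → cubeSum n (f ∘ ((false xor b) ∷_)) + cubeSum n (f ∘ ((true xor b) ∷_))
                    ≡ cubeSum n (f ∘ (false ∷_)) + cubeSum n (f ∘ (true ∷_))
  swap-halves false = refl
  swap-halves true  = +-comm (cubeSum n (f ∘ (true ∷_))) _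

length-allVecs : ∀ n → length (allVecs n) ≡ 2 ^ n
length-allVecs zero    = refl
length-allVecs (suc n) = begin
  length (map (false ∷_) (allVecs n) ++ map (true ∷_) (allVecs n))
    ≡⟨ length-++ (map (false ∷_) (allVecs n)) ⟩
  length (map (false ∷_) (allVecs n)) + length (map (true ∷_) (allVecs n))
    ≡⟨ cong₂ _+_ (length-map (false ∷_) (allVecs n)) (length-map (true ∷_) (allVecs n)) ⟩
  length (allVecs n) + length (allVecs n)
    ≡⟨ cong₂ _+_ (length-allVecs n) (trans (length-allVecs n) (sym (+-identityʳ _))) ⟩
  2 ^ suc n ∎

∈-allVecs : ∀ {n} (x : Vec Bool n) → x ∈ allVecs n
∈-allVecs []          = here refl
∈-allVecs (false ∷ x) = ∈-++⁺ˡ (∈-map⁺ (false ∷_) (∈-allVecs x))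
∈-allVecs (true ∷ x)  = ∈-++⁺ʳ (map (false ∷_) (allVecs _)) (∈-map⁺ (true ∷_) (∈-allVecs x))

allVecs-unique : ∀ n → Unique (allVecs n)
allVecs-unique zero    = [] ∷ []
allVecs-unique (suc n) = ++⁺ (map⁺ tail-injective (allVecs-unique n)) (map⁺ tail-injective (allVecs-unique n)) disjoint
  where
  tail-injective : ∀ {b} {x y : Vec Bool n} → b ∷ x ≡ b ∷ y → x ≡ y
  tail-injective refl = refl
  disjoint : ∀ {v} → ¬ (v ∈ map (false ∷_) (allVecs n) × v ∈ map (true ∷_) (allVecs n))
  disjoint (p , q) with ∈-map⁻ (false ∷_) p | ∈-map⁻ (true ∷_) q
  ... | _ , _ , refl | _ , _ , ()

-- Z₂ⁿ acting on the vertices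

module _ {n N : ℕ} (A : Chromotopology n N) where

  nbr-comm : ∀ i j v → nbr A j (nbr A i v) ≡ nbr A i (nbr A j v)
  nbr-comm i j v with i ≟ j
  ... | yes refl = refl
  ... | no  i≢j  = begin
    nbr A j (nbr A i v)
      ≡⟨ involutive A i _ ⟨
    nbr A i (nbr A i (nbr A j (nbr A i v)))
      ≡⟨ cong (nbr A i) (involutive A j _) ⟨
    nbr A i (nbr A j (nbr A j (nbr A i (nbr A j (nbr A i v)))))
      ≡⟨ cong (nbr A i ∘ nbr A j) (squares A i j v i≢j) ⟩
    nbr A i (nbr A j v) ∎

  move : Vec Bool n → Fin n → Fin N → Fin N
  move x i v = if lookup x i then nbr A i v else v

  move-comm : ∀ x y i j v → move x i (move y j v) ≡ move y j (move x i v)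
  move-comm x y i j v with lookup x i | lookup y j
  ... | true  | true  = sym (nbr-comm i j v)
  ... | true  | false = refl
  ... | false | true  = refl
  ... | false | false = refl

  move-⊕ : ∀ x y i v → move (x ⊕ y) i v ≡ move x i (move y i v)
  move-⊕ x y i v rewrite lookup-zipWith _xor_ i x y with lookup x i | lookup y i
  ... | true  | true  = sym (involutive A i v)
  ... | true  | false = refl
  ... | false | true  = refl
  ... | false | false = refl

  actOver : Vec Bool n → List (Fin n) → Fin N → Fin N
  actOver x is v = foldr (move x) v is

  move-actOver : ∀ y j x is v → move y j (actOver x is v) ≡ actOver x is (move y j v)
  move-actOver y j x []       v = refl
  move-actOver y j x (i ∷ is) v = trans (move-comm y x j i _) (cong (move x i) (move-actOver y j x is v))

  actOver-⊕ : ∀ x y is v → actOver (x ⊕ y) is v ≡ actOver x is (actOver y is v)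
  actOver-⊕ x y []       v = refl
  actOver-⊕ x y (i ∷ is) v = begin
    move (x ⊕ y) i (actOver (x ⊕ y) is v)               ≡⟨ cong (move (x ⊕ y) i) (actOver-⊕ x y is v) ⟩
    move (x ⊕ y) i (actOver x is (actOver y is v))      ≡⟨ move-⊕ x y i _ ⟩
    move x i (move y i (actOver x is (actOver y is v))) ≡⟨ cong (move x i) (move-actOver y i x is _) ⟩
    move x i (actOver x is (move y i (actOver y is v))) ∎

  act-⊕ : ∀ x y v → act A (x ⊕ y) v ≡ act A x (act A y v)
  act-⊕ x y = actOver-⊕ x y (allFin n)

  unitVec : Fin n → Vec Bool n
  unitVec i = tabulate λ j → isYes (j ≟ i)

  lookup-unitVec : ∀ i j → lookup (unitVec i) j ≡ isYes (j ≟ i)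
  lookup-unitVec i j = lookup∘tabulate _ j

  move-unitVec-self : ∀ i v → move (unitVec i) i v ≡ nbr A i v
  move-unitVec-self i v rewrite lookup-unitVec i i with i ≟ i
  ... | yes _   = refl
  ... | no  i≢i = ⊥-elim (i≢i refl)

  move-unitVec-≢ : ∀ {i j} v → j ≢ i → move (unitVec i) j v ≡ v
  move-unitVec-≢ {i} {j} v j≢i rewrite lookup-unitVec i j with j ≟ i
  ... | yes j≡i = ⊥-elim (j≢i j≡i)
  ... | no  _   = refl

  actOver-unitVec-∉ : ∀ i is v → i ∉ is → actOver (unitVec i) is v ≡ v
  actOver-unitVec-∉ i []       v _  = refl
  actOver-unitVec-∉ i (j ∷ is) v i∉ =
    trans (move-unitVec-≢ _ λ j≡i → i∉ (here (sym j≡i))) (actOver-unitVec-∉ i is v (i∉ ∘ there))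

  actOver-unitVec-∈ : ∀ i is v → Unique is → i ∈ is → actOver (unitVec i) is v ≡ nbr A i v
  actOver-unitVec-∈ i (i ∷ is) v (i∉ ∷ _) (here refl) =
    trans (move-unitVec-self i _) (cong (nbr A i) (actOver-unitVec-∉ i is v (All¬⇒¬Any i∉)))
  actOver-unitVec-∈ i (j ∷ is) v (j∉ ∷ u) (there i∈) =
    trans (move-unitVec-≢ _ (All.lookup j∉ i∈)) (actOver-unitVec-∈ i is v u i∈)

  act-unitVec : ∀ i v → act A (unitVec i) v ≡ nbr A i v
  act-unitVec i v = actOver-unitVec-∈ i (allFin n) v (allFin⁺ n) (∈-allFin i)

  actOver-zero : ∀ is v → actOver (replicate n false) is v ≡ v
  actOver-zero []       v = refl
  actOver-zero (i ∷ is) v rewrite lookup-replicate i false = actOver-zero is v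

  act-transitive : ∀ {v w} → Conn (nbr A) v w → Σ (Vec Bool n) λ x → act A x v ≡ w
  act-transitive {v} here       = replicate n false , actOver-zero (allFin n) v
  act-transitive {v} (step i p) with act-transitive p
  ... | x , x·iv≡w =
    x ⊕ unitVec i , trans (act-⊕ x (unitVec i) v) (trans (cong (act A x) (act-unitVec i v)) x·iv≡w)

  fixes⇒InL : ∀ x w → act A x w ≡ w → InL A x
  fixes⇒InL x w x·w≡w u with act-transitive (connected A w u)
  ... | y , y·w≡u = begin
    act A x u           ≡⟨ cong (act A x) y·w≡u ⟨
    act A x (act A y w) ≡⟨ act-⊕ x y w ⟨
    act A (x ⊕ y) w     ≡⟨ cong (λ z → act A z w) (zipWith-comm xor-comm x y) ⟩
    act A (y ⊕ x) w     ≡⟨ act-⊕ y x w ⟩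
    act A y (act A x w) ≡⟨ cong (act A y) x·w≡w ⟩
    act A y w           ≡⟨ y·w≡u ⟩
    u                   ∎

  fibreSize : ∀ k → IsNK A k → ∀ v w → cubeSum n (λ x → χ (act A x v ≟ w)) ≡ 2 ^ k
  fibreSize k nk v w with act-transitive (connected A v w)
  ... | y , y·v≡w = begin
    cubeSum n (λ x → χ (act A x v ≟ w))         ≡⟨ cubeSum-translate n y _ ⟨
    cubeSum n (λ x → χ (act A (x ⊕ y) v ≟ w))   ≡⟨ cong sum (map-cong inFibre≡inL (allVecs n)) ⟩
    cubeSum n (χ ∘ inL? A)                      ≡⟨ length-filter≡sum-χ (inL? A) (allVecs n) ⟨
    length (filter (inL? A) (allVecs n))        ≡⟨ nk ⟩
    2 ^ k                                       ∎
    where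
    shift : ∀ x → act A (x ⊕ y) v ≡ act A x w
    shift x = trans (act-⊕ x y v) (cong (act A x) y·v≡w)
    inFibre≡inL : ∀ x → χ (act A (x ⊕ y) v ≟ w) ≡ χ (inL? A x)
    inFibre≡inL x = χ-iff _ _ (λ x·yv≡w → fixes⇒InL x w (trans (sym (shift x)) x·yv≡w))
                              (λ x∈L → trans (shift x) (x∈L w))

  orbitStabiliser : ∀ k → IsNK A k → Fin N → N * 2 ^ k ≡ 2 ^ n
  orbitStabiliser k nk v = begin
    N * 2 ^ k
      ≡⟨ ∑-const N (2 ^ k) ⟨
    ∑[ w < N ] (2 ^ k)
      ≡⟨ sum-cong-≗ (fibreSize k nk v) ⟨
    ∑[ w < N ] cubeSum n (λ x → χ (act A x v ≟ w))
      ≡⟨ sum-map-∑-comm (λ x w → χ (act A x v ≟ w)) (allVecs n) ⟨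
    cubeSum n (λ x → ∑[ w < N ] χ (act A x v ≟ w))
      ≡⟨ cong sum (map-cong (∑-χ-≟ ∘ λ x → act A x v) (allVecs n)) ⟩
    cubeSum n (const 1)
      ≡⟨ cubeSum-one n ⟩
    2 ^ n ∎

-- With no vertices, L is all of Z₂ⁿ, so 2^(n - k) = 1 rather than N.
vertexCount-pred : ∀ {n N} (A : Chromotopology n N) k → IsNK A k → N ∸ 1 ≡ 2 ^ (n ∸ k) ∸ 1
vertexCount-pred {n} {zero} A k nk = cong (_∸ 1) (m*2^k≡2^n⇒m≡2^[n∸k] 1 k n (begin
  1 * 2 ^ k                             ≡⟨ *-identityˡ _ ⟩
  2 ^ k                                 ≡⟨ nk ⟨
  length (filter (inL? A) (allVecs n))  ≡⟨ cong length (filter-all (inL? A) (universal (λ x ()) (allVecs n))) ⟩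
  length (allVecs n)                    ≡⟨ length-allVecs n ⟩
  2 ^ n                                 ∎))
vertexCount-pred {n} {suc M} A k nk =
  cong (_∸ 1) (m*2^k≡2^n⇒m≡2^[n∸k] (suc M) k n (orbitStabiliser A k nk zero))

-- Vertex switching

_∆_ : ∀ {X : Set} → (X → Bool) → (X → Bool) → X → Bool
(S ∆ T) v = S v xor T v

∅ : ∀ {X : Set} → X → Bool
∅ _ = false

⁅_⁆ : ∀ {N} → Fin N → Fin N → Bool
⁅ v ⁆ w = isYes (w ≟ v)

parity : ∀ {N} → List (Fin N) → Fin N → Bool
parity []       = ∅
parity (v ∷ vs) = ⁅ v ⁆ ∆ parity vs

parity-∉ : ∀ {N} {vs : List (Fin N)} {w} → w ∉ vs → parity vs w ≡ false
parity-∉ {vs = []}     _  = refl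
parity-∉ {vs = v ∷ vs} {w} w∉ with w ≟ v
... | yes w≡v = ⊥-elim (w∉ (here w≡v))
... | no  _   = parity-∉ (w∉ ∘ there)

parity-∈ : ∀ {N} {vs : List (Fin N)} {w} → Unique vs → w ∈ vs → parity vs w ≡ true
parity-∈ {vs = w ∷ vs} {w} (w∉ ∷ _) (here refl) with w ≟ w
... | yes _   = cong (true xor_) (parity-∉ (All¬⇒¬Any w∉))
... | no  w≢w = ⊥-elim (w≢w refl)
parity-∈ {vs = v ∷ vs} {w} (v∉ ∷ u) (there w∈) with w ≟ v
... | yes refl = ⊥-elim (All¬⇒¬Any v∉ w∈)
... | no  _    = parity-∈ u w∈

parity-filterᵇ : ∀ {N} (S : Fin N → Bool) {vs} → Unique vs → ∀ {w} → w ∈ vs →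
  parity (filterᵇ S vs) w ≡ S w
parity-filterᵇ S {vs} u {w} w∈ with S w in Sw≡b
... | true  = parity-∈ (filter⁺ (T? ∘ S) u) (∈-filter⁺ (T? ∘ S) w∈ (subst T (sym Sw≡b) tt))
... | false = parity-∉ {vs = filterᵇ S vs} λ w∈S →
  subst T Sw≡b (proj₂ (∈-filter⁻ (T? ∘ S) {xs = vs} w∈S))

module _ {n N : ℕ} (A : Chromotopology n N) where

  coboundary : (Fin N → Bool) → Fin n → Fin N → Bool
  coboundary S i v = S v xor S (nbr A i v)

  coboundary-∆ : ∀ S T i v → coboundary (S ∆ T) i v ≡ coboundary S i v xor coboundary T i v
  coboundary-∆ S T i v = interchange (S v) (T v) (S (nbr A i v)) (T (nbr A i v))

  coboundary-const : ∀ S c i v → coboundary (S ∆ const c) i v ≡ coboundary S i v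
  coboundary-const S c i v = begin
    coboundary (S ∆ const c) i v       ≡⟨ coboundary-∆ S (const c) i v ⟩
    coboundary S i v xor (c xor c)     ≡⟨ cong (coboundary S i v xor_) (xor-same c) ⟩
    coboundary S i v xor false         ≡⟨ xor-identityʳ _ ⟩
    coboundary S i v                   ∎

  coboundary-nbr : ∀ S i v → coboundary S i (nbr A i v) ≡ coboundary S i v
  coboundary-nbr S i v = trans (cong (S (nbr A i v) xor_) (cong S (involutive A i v))) (xor-comm (S (nbr A i v)) (S v))

  coboundary-square : ∀ S i j v → i ≢ j →
    let a = nbr A i v; b = nbr A j a; c = nbr A i b
    in (coboundary S i v xor coboundary S j a) xor (coboundary S i b xor coboundary S j c) ≡ false
  coboundary-square S i j v i≢j = begin
    ((S v xor S a) xor (S a xor S b)) xor ((S b xor S c) xor (S c xor S (nbr A j c)))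
      ≡⟨ cong₂ _xor_ (xor-telescope (S v) (S a) (S b)) (xor-telescope (S b) (S c) _) ⟩
    (S v xor S b) xor (S b xor S (nbr A j c))   ≡⟨ xor-telescope (S v) (S b) _ ⟩
    S v xor S (nbr A j c)                       ≡⟨ cong (λ u → S v xor S u) (squares A i j v i≢j) ⟩
    S v xor S v                                 ≡⟨ xor-same (S v) ⟩
    false                                       ∎
    where
    a = nbr A i v
    b = nbr A j a
    c = nbr A i b

  coboundary≡false⇒constant : ∀ S → (∀ i v → coboundary S i v ≡ false) → ∀ v w → S v ≡ S w
  coboundary≡false⇒constant S δS≡0 v w = along (connected A v w)
    where
    along : ∀ {v w} → Conn (nbr A) v w → S v ≡ S w
    along here       = refl
    along (step i p) = trans (xor≡false⇒≡ _ _ (δS≡0 i _)) (along p)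

  switchBy : (Fin N → Bool) → Dashing n N → Dashing n N
  switchBy S d = tabulate λ i → tabulate λ v → val d i v xor coboundary S i v

  val-switchBy : ∀ S d i v → val (switchBy S d) i v ≡ val d i v xor coboundary S i v
  val-switchBy S d = val-tabulate λ i v → val d i v xor coboundary S i v

  switchBy-cong : ∀ {S T} d → (∀ v → S v ≡ T v) → switchBy S d ≡ switchBy T d
  switchBy-cong {S} {T} d S≗T = dashing-ext λ i v → begin
    val (switchBy S d) i v          ≡⟨ val-switchBy S d i v ⟩
    val d i v xor coboundary S i v  ≡⟨ cong₂ (λ x y → val d i v xor (x xor y)) (S≗T v) (S≗T (nbr A i v)) ⟩
    val d i v xor coboundary T i v  ≡⟨ val-switchBy T d i v ⟨
    val (switchBy T d) i v          ∎

  switchBy-∅ : ∀ d → switchBy ∅ d ≡ d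
  switchBy-∅ d = dashing-ext λ i v → trans (val-switchBy ∅ d i v) (xor-identityʳ _)

  switchBy-∆ : ∀ S T d → switchBy S (switchBy T d) ≡ switchBy (T ∆ S) d
  switchBy-∆ S T d = dashing-ext λ i v → begin
    val (switchBy S (switchBy T d)) i v                        ≡⟨ val-switchBy S (switchBy T d) i v ⟩
    val (switchBy T d) i v xor coboundary S i v                ≡⟨ cong (_xor coboundary S i v) (val-switchBy T d i v) ⟩
    (val d i v xor coboundary T i v) xor coboundary S i v      ≡⟨ xor-assoc (val d i v) _ _ ⟩
    val d i v xor (coboundary T i v xor coboundary S i v)      ≡⟨ cong (val d i v xor_) (coboundary-∆ T S i v) ⟨
    val d i v xor coboundary (T ∆ S) i v                       ≡⟨ val-switchBy (T ∆ S) d i v ⟨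
    val (switchBy (T ∆ S) d) i v                               ∎

  switchBy-∆-const : ∀ S c d → switchBy (S ∆ const c) d ≡ switchBy S d
  switchBy-∆-const S c d = dashing-ext λ i v → begin
    val (switchBy (S ∆ const c) d) i v         ≡⟨ val-switchBy (S ∆ const c) d i v ⟩
    val d i v xor coboundary (S ∆ const c) i v ≡⟨ cong (val d i v xor_) (coboundary-const S c i v) ⟩
    val d i v xor coboundary S i v             ≡⟨ val-switchBy S d i v ⟨
    val (switchBy S d) i v                     ∎

  -- No edge is a loop, so the two endpoint tests in `switch` never both hold and their ∨ is a xor.
  switch≡switchBy⁅⁆ : ∀ v d → switch A v d ≡ switchBy ⁅ v ⁆ d
  switch≡switchBy⁅⁆ v d = dashing-ext λ i w →
    trans (val-tabulate _ i w) (trans (cong (val d i w xor_) (∨≡xor i w)) (sym (val-switchBy ⁅ v ⁆ d i w)))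
    where
    ∨≡xor : ∀ i w → ⁅ v ⁆ w ∨ ⁅ v ⁆ (nbr A i w) ≡ coboundary ⁅ v ⁆ i w
    ∨≡xor i w with w ≟ v | nbr A i w ≟ v
    ... | yes w≡v | yes iw≡v = ⊥-elim (loopless A i w (trans iw≡v (sym w≡v)))
    ... | yes _   | no  _    = refl
    ... | no  _   | yes _    = refl
    ... | no  _   | no  _    = refl

  switchBy-odd : ∀ S {d} → OddDashing A d → OddDashing A (switchBy S d)
  switchBy-odd S {d} (edgeMap , odd) = edgeMap′ , odd′
    where
    edgeMap′ : IsEdgeMap A (switchBy S d)
    edgeMap′ i v = begin
      val (switchBy S d) i v                             ≡⟨ val-switchBy S d i v ⟩
      val d i v xor coboundary S i v                     ≡⟨ cong₂ _xor_ (edgeMap i v) (sym (coboundary-nbr S i v)) ⟩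
      val d i (nbr A i v) xor coboundary S i (nbr A i v) ≡⟨ val-switchBy S d i _ ⟨
      val (switchBy S d) i (nbr A i v)                   ∎
    odd′ : ∀ i j v → i ≢ j → let a = nbr A i v; b = nbr A j a; c = nbr A i b in
      (val (switchBy S d) i v xor val (switchBy S d) j a) xor (val (switchBy S d) i b xor val (switchBy S d) j c) ≡ true
    odd′ i j v i≢j = begin
      (val (switchBy S d) i v xor val (switchBy S d) j a) xor (val (switchBy S d) i b xor val (switchBy S d) j c)
        ≡⟨ cong₂ _xor_ (cong₂ _xor_ (val-switchBy S d i v) (val-switchBy S d j a))
                       (cong₂ _xor_ (val-switchBy S d i b) (val-switchBy S d j c)) ⟩
      ((val d i v xor δ i v) xor (val d j a xor δ j a)) xor ((val d i b xor δ i b) xor (val d j c xor δ j c))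
        ≡⟨ xor-perturb (val d i v) (val d j a) (val d i b) (val d j c) _ _ _ _ (coboundary-square S i j v i≢j) ⟩
      (val d i v xor val d j a) xor (val d i b xor val d j c)
        ≡⟨ odd i j v i≢j ⟩
      true ∎
      where
      δ = coboundary S
      a = nbr A i v
      b = nbr A j a
      c = nbr A i b

  switchBy-injective : ∀ S T d → switchBy S d ≡ switchBy T d → ∀ v → S v ≡ T v → ∀ w → S w ≡ T w
  switchBy-injective S T d eq v Sv≡Tv w =
    xor≡false⇒≡ _ _ (trans (sym (coboundary≡false⇒constant (S ∆ T) δ≡0 v w)) (≡⇒xor≡false Sv≡Tv))
    where
    δS≡δT : ∀ i v → coboundary S i v ≡ coboundary T i v
    δS≡δT i v = xor-cancelˡ (val d i v) _ _
      (trans (sym (val-switchBy S d i v)) (trans (cong (λ e → val e i v) eq) (val-switchBy T d i v)))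
    δ≡0 : ∀ i v → coboundary (S ∆ T) i v ≡ false
    δ≡0 i v = trans (coboundary-∆ S T i v) (≡⇒xor≡false (δS≡δT i v))

  sameClass⇒switchBy : ∀ {d e} → SameClass A d e → Σ (Fin N → Bool) λ S → e ≡ switchBy S d
  sameClass⇒switchBy {d} refl-cls = ∅ , sym (switchBy-∅ d)
  sameClass⇒switchBy {d} (step-cls v p) with sameClass⇒switchBy p
  ... | S , e≡ =
    ⁅ v ⁆ ∆ S , trans e≡ (trans (cong (switchBy S) (switch≡switchBy⁅⁆ v d)) (switchBy-∆ S ⁅ v ⁆ d))

  sameClass-parity : ∀ vs d → SameClass A d (switchBy (parity vs) d)
  sameClass-parity []       d = subst (SameClass A d) (sym (switchBy-∅ d)) refl-cls
  sameClass-parity (v ∷ vs) d =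
    step-cls v (subst (SameClass A (switch A v d)) switchVs (sameClass-parity vs (switch A v d)))
    where
    switchVs : switchBy (parity vs) (switch A v d) ≡ switchBy (parity (v ∷ vs)) d
    switchVs = trans (cong (switchBy (parity vs)) (switch≡switchBy⁅⁆ v d)) (switchBy-∆ (parity vs) ⁅ v ⁆ d)

  switchBy⇒sameClass : ∀ S d → SameClass A d (switchBy S d)
  switchBy⇒sameClass S d = subst (SameClass A d)
    (switchBy-cong d λ w → parity-filterᵇ S (allFin⁺ N) (∈-allFin w))
    (sameClass-parity (filterᵇ S (allFin N)) d)

switchingClass-enumeration : ∀ {n N} (A : Chromotopology n N) (d : Dashing n N) → OddDashing A d →
  Σ (List (Dashing n N)) λ ds →
    Unique ds × (∀ e → (e ∈ ds) ⇔ (OddDashing A e × SameClass A d e)) × length ds ≡ 2 ^ (N ∸ 1)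
switchingClass-enumeration {N = zero} A d odd =
  d ∷ [] , [] ∷ [] ,
  (λ e → mk⇔ (λ { (here refl) → odd , refl-cls }) (λ _ → here (dashing-ext λ _ ()))) ,
  refl
switchingClass-enumeration {n} {suc M} A d odd =
  map f (allVecs M) , map⁺ f-injective (allVecs-unique M) , (λ e → mk⇔ (sound e) (complete e)) ,
  trans (length-map f (allVecs M)) (length-allVecs M)
  where
  -- Vertex sets avoiding vertex zero: one of each pair S, S ∆ const true, which switch alike.
  pointed : Vec Bool M → Fin (suc M) → Bool
  pointed s = lookup (false ∷ s)

  f : Vec Bool M → Dashing n (suc M)
  f s = switchBy A (pointed s) d

  f-injective : ∀ {s t} → f s ≡ f t → s ≡ t
  f-injective eq = lookup-ext λ j → switchBy-injective A (pointed _) (pointed _) d eq zero refl (suc j)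

  sound : ∀ e → e ∈ map f (allVecs M) → OddDashing A e × SameClass A d e
  sound e e∈ with ∈-map⁻ f e∈
  ... | s , _ , refl = switchBy-odd A (pointed s) {d} odd , switchBy⇒sameClass A (pointed s) d

  complete : ∀ e → OddDashing A e × SameClass A d e → e ∈ map f (allVecs M)
  complete e (_ , d~e) with sameClass⇒switchBy A d~e
  ... | S , refl = subst (_∈ map f (allVecs M)) (sym S-normalised) (∈-map⁺ f (∈-allVecs s))
    where
    s : Vec Bool M
    s = tabulate λ j → S (suc j) xor S zero
    pointed-s : ∀ v → (S ∆ const (S zero)) v ≡ pointed s v
    pointed-s zero    = xor-same (S zero)
    pointed-s (suc j) = sym (lookup∘tabulate _ j)
    S-normalised : switchBy A S d ≡ f s
    S-normalised = trans (sym (switchBy-∆-const A S (S zero) d)) (switchBy-cong A d pointed-s)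

mainTheorem11 : (n k N : ℕ) (A : Chromotopology n N) → IsNK A k → Adinkraizable A →
    (d : Dashing n N) → OddDashing A d →
    Σ (List (Dashing n N)) λ ds →
      Unique ds ×
      (∀ e → (e ∈ ds) ⇔ (OddDashing A e × SameClass A d e)) ×
      length ds ≡ 2 ^ (2 ^ (n ∸ k) ∸ 1)
mainTheorem11 n k N A nk _ d odd =
  let ds , unique , members , size = switchingClass-enumeration A d odd
  in  ds , unique , members , trans size (cong (2 ^_) (vertexCount-pred A k nk))
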